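{- Let $d\ge1$, $\pi\in\mathbb{Z}^d_{>0}$, $T$ a positive integer, and $Q=\mathbb{Z}^d\cap\{c\in\mathbb{R}^d_{\ge 0}:\pi\cdot c\le T\}$. Let $c\in Q$ be a complex configuration. Then there exist $c_1,c_2\in Q$ such that (1) $\pi\cdot c_1=\pi\cdot c_2=\pi\cdot c$; (2) $2c=c_1+c_2$; (3) $\mathrm{supp}(c_1)\subsetneq\mathrm{supp}(c)$ and $\mathrm{supp}(c_2)\subsetneq\mathrm{supp}(c)$.
   Context: $\log=\log_2$; $\mathrm{supp}(a)=\{i:a_i\ne 0\}$. Elements of $Q$ are configurations; $c\in Q$ is simple if $|\mathrm{supp}(c)|\le\log(T+1)$ and complex otherwise. -}

module Defs where

open import Data.Nat using (ℕ; zero; suc; _+_; _*_; _≤_; _<_)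
open import Data.Nat.Logarithm using (⌊log₂_⌋)
open import Data.Vec using (Vec; []; _∷_; zipWith; map)
open import Data.Fin.Subset using (Subset; inside; outside; ∣_∣)

_·_ : ∀ {d} → Vec ℕ d → Vec ℕ d → ℕ
[] · [] = 0
(x ∷ xs) · (y ∷ ys) = x * y + xs · ys

supp : ∀ {d} → Vec ℕ d → Subset d
supp [] = []
supp (zero ∷ xs) = outside ∷ supp xs
supp (suc _ ∷ xs) = inside ∷ supp xs

-- Q = Z^d ∩ {c ≥ 0 : π·c ≤ T}; nonnegative integer vectors are Vec ℕ d
InQ : ∀ {d} → Vec ℕ d → ℕ → Vec ℕ d → Set
InQ π T c = π · c ≤ T

-- c is complex iff |supp c| > log₂(T+1); since |supp c| is an integer,
-- this is equivalent to |supp c| > ⌊log₂(T+1)⌋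
Complex : ∀ {d} → ℕ → Vec ℕ d → Set
Complex T c = ⌊log₂ (suc T) ⌋ < ∣ supp c ∣

double : ∀ {d} → Vec ℕ d → Vec ℕ d
double = map (2 *_)

-- Let k = |supp c|. The 2^k subsets s of supp c have weights π · c|ₛ in
-- {0, …, T}, and 2^k > T + 1 because c is complex, so two distinct subsets
-- s, t have equal weight; then so do s ∖ t and t ∖ s, and both meet supp c
-- since one of them does and π > 0. Moving the mass of c on t ∖ s onto s ∖ t
-- (doubling the entries on s ∖ t, zeroing those on t ∖ s) gives c₁, and the
-- opposite move gives c₂: both keep π · c, they average to c, and each loses
-- part of the support.
module Submission where

open import Defs
open import Data.Nat using (ℕ; zero; suc; _+_; _*_; _^_; _≤_; _<_; _≥_; z≤n; s≤s)
open import Data.Nat.Properties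
open import Data.Nat.Logarithm using (⌊log₂_⌋; ⌊log₂⌋-mono-≤; ⌊log₂[2^n]⌋≡n)
open import Algebra.Properties.CommutativeSemigroup +-commutativeSemigroup using (interchange)
open import Data.Vec using (Vec; []; _∷_; zipWith)
open import Data.Vec.Properties using (∷-injectiveˡ; ∷-injectiveʳ)
open import Data.Vec.Relation.Unary.All using (All; _∷_)
open import Data.Vec.Base using (here; there)
open import Data.Fin using (Fin; zero; suc; combine; remQuot; fromℕ<)
import Data.Fin.Properties as Fin
open import Data.Fin.Subset
  using (Subset; Side; inside; outside; _∈_; _⊆_; _⊂_; _∩_; _─_; Nonempty; ∣_∣)
open import Data.Fin.Subset.Properties using (x∈p∩q⁺; p─q⊆p; p∩q≢∅⇒p─q⊂p; ∩-comm)
open import Data.Product using (Σ; _×_; _,_; ∃₂; uncurry)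
import Data.Product as Product
open import Data.Sum using (inj₁; inj₂; _⊎_)
import Data.Sum as Sum
open import Function using (_∘_)
open import Relation.Nullary using (contradiction)
open import Relation.Binary.PropositionalEquality
  using (_≡_; _≢_; refl; sym; trans; cong; cong₂; subst; module ≡-Reasoning)

private
  variable
    d : ℕ

infixl 6 _⊕_

_⊕_ : Vec ℕ d → Vec ℕ d → Vec ℕ d
_⊕_ = zipWith _+_

restrict : Vec ℕ d → Subset d → Vec ℕ d
restrict []      []            = []
restrict (n ∷ c) (inside  ∷ s) = n ∷ restrict c s
restrict (n ∷ c) (outside ∷ s) = 0 ∷ restrict c s

shiftEntry : Side → Side → ℕ → ℕ
shiftEntry inside  outside n = n + n
shiftEntry outside inside  n = 0
shiftEntry inside  inside  n = n
shiftEntry outside outside n = n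

shift : Vec ℕ d → Subset d → Subset d → Vec ℕ d
shift []      []      []       = []
shift (n ∷ c) (b ∷ s) (b′ ∷ t) = shiftEntry b b′ n ∷ shift c s t

·-distribˡ-⊕ : (π u v : Vec ℕ d) → π · (u ⊕ v) ≡ π · u + π · v
·-distribˡ-⊕ []      []      []      = refl
·-distribˡ-⊕ (p ∷ π) (x ∷ u) (y ∷ v) = begin
  p * (x + y) + π · (u ⊕ v)         ≡⟨ cong₂ _+_ (*-distribˡ-+ p x y) (·-distribˡ-⊕ π u v) ⟩
  (p * x + p * y) + (π · u + π · v) ≡⟨ interchange (p * x) (p * y) (π · u) (π · v) ⟩
  (p * x + π · u) + (p * y + π · v) ∎
  where open ≡-Reasoning

·-pos : {π v : Vec ℕ d} → All (0 <_) π → Nonempty (supp v) → 0 < π · v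
·-pos {π = p ∷ _} {suc m ∷ _} (p>0 ∷ _)  (zero , here) =
  <-≤-trans (*-mono-< p>0 (s≤s z≤n)) (m≤m+n _ _)
·-pos {v = zero  ∷ _} (_ ∷ π>0) (suc i , there i∈v) = <-≤-trans (·-pos π>0 (i , i∈v)) (m≤n+m _ _)
·-pos {v = suc _ ∷ _} (_ ∷ π>0) (suc i , there i∈v) = <-≤-trans (·-pos π>0 (i , i∈v)) (m≤n+m _ _)

·-pos⁻ : (π v : Vec ℕ d) → 0 < π · v → Nonempty (supp v)
·-pos⁻ []      []          ()
·-pos⁻ (p ∷ π) (suc m ∷ v) _   = zero , here
·-pos⁻ (p ∷ π) (zero  ∷ v) pos =
  Product.map suc there (·-pos⁻ π v (subst (λ x → 0 < x + π · v) (*-zeroʳ p) pos))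

·-restrict-≤ : (π c : Vec ℕ d) (s : Subset d) → π · restrict c s ≤ π · c
·-restrict-≤ []      []      []            = z≤n
·-restrict-≤ (p ∷ π) (n ∷ c) (inside  ∷ s) = +-monoʳ-≤ (p * n) (·-restrict-≤ π c s)
·-restrict-≤ (p ∷ π) (n ∷ c) (outside ∷ s) = +-mono-≤ (*-monoʳ-≤ p z≤n) (·-restrict-≤ π c s)

supp-restrict : (c : Vec ℕ d) (s : Subset d) → supp (restrict c s) ≡ supp c ∩ s
supp-restrict []          []            = refl
supp-restrict (zero  ∷ c) (inside  ∷ s) = cong (outside ∷_) (supp-restrict c s)
supp-restrict (zero  ∷ c) (outside ∷ s) = cong (outside ∷_) (supp-restrict c s)
supp-restrict (suc _ ∷ c) (inside  ∷ s) = cong (inside ∷_)  (supp-restrict c s)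
supp-restrict (suc _ ∷ c) (outside ∷ s) = cong (outside ∷_) (supp-restrict c s)

supp-shift : (c : Vec ℕ d) (s t : Subset d) → supp (shift c s t) ≡ supp c ─ (t ─ s)
supp-shift []          []            []             = refl
supp-shift (zero  ∷ c) (inside  ∷ s) (inside  ∷ t) = cong (outside ∷_) (supp-shift c s t)
supp-shift (zero  ∷ c) (inside  ∷ s) (outside ∷ t) = cong (outside ∷_) (supp-shift c s t)
supp-shift (zero  ∷ c) (outside ∷ s) (inside  ∷ t) = cong (outside ∷_) (supp-shift c s t)
supp-shift (zero  ∷ c) (outside ∷ s) (outside ∷ t) = cong (outside ∷_) (supp-shift c s t)
supp-shift (suc _ ∷ c) (inside  ∷ s) (inside  ∷ t) = cong (inside ∷_)  (supp-shift c s t)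
supp-shift (suc _ ∷ c) (inside  ∷ s) (outside ∷ t) = cong (inside ∷_)  (supp-shift c s t)
supp-shift (suc _ ∷ c) (outside ∷ s) (inside  ∷ t) = cong (outside ∷_) (supp-shift c s t)
supp-shift (suc _ ∷ c) (outside ∷ s) (outside ∷ t) = cong (inside ∷_)  (supp-shift c s t)

supp-shift-⊂ : (c : Vec ℕ d) (s t : Subset d) →
  Nonempty (supp c ∩ (t ─ s)) → supp (shift c s t) ⊂ supp c
supp-shift-⊂ c s t ne =
  subst (_⊂ supp c) (sym (supp-shift c s t)) (p∩q≢∅⇒p─q⊂p (supp c) (t ─ s) ne)

restrict-∩-⊕-─ : (c : Vec ℕ d) (s t : Subset d) →
  restrict c s ≡ restrict c (s ∩ t) ⊕ restrict c (s ─ t)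
restrict-∩-⊕-─ []      []            []            = refl
restrict-∩-⊕-─ (n ∷ c) (inside  ∷ s) (inside  ∷ t) =
  cong₂ _∷_ (sym (+-identityʳ n)) (restrict-∩-⊕-─ c s t)
restrict-∩-⊕-─ (n ∷ c) (inside  ∷ s) (outside ∷ t) = cong (n ∷_) (restrict-∩-⊕-─ c s t)
restrict-∩-⊕-─ (n ∷ c) (outside ∷ s) (inside  ∷ t) = cong (0 ∷_) (restrict-∩-⊕-─ c s t)
restrict-∩-⊕-─ (n ∷ c) (outside ∷ s) (outside ∷ t) = cong (0 ∷_) (restrict-∩-⊕-─ c s t)

shift-⊕-restrict : (c : Vec ℕ d) (s t : Subset d) →
  shift c s t ⊕ restrict c t ≡ c ⊕ restrict c s
shift-⊕-restrict []      []            []            = refl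
shift-⊕-restrict (n ∷ c) (inside  ∷ s) (inside  ∷ t) = cong (n + n ∷_) (shift-⊕-restrict c s t)
shift-⊕-restrict (n ∷ c) (inside  ∷ s) (outside ∷ t) =
  cong₂ _∷_ (+-identityʳ (n + n)) (shift-⊕-restrict c s t)
shift-⊕-restrict (n ∷ c) (outside ∷ s) (inside  ∷ t) =
  cong₂ _∷_ (sym (+-identityʳ n)) (shift-⊕-restrict c s t)
shift-⊕-restrict (n ∷ c) (outside ∷ s) (outside ∷ t) = cong (n + 0 ∷_) (shift-⊕-restrict c s t)

double≡shift⊕shift : (c : Vec ℕ d) (s t : Subset d) → double c ≡ shift c s t ⊕ shift c t s
double≡shift⊕shift []      []      []       = refl
double≡shift⊕shift (n ∷ c) (b ∷ s) (b′ ∷ t) =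
  cong₂ _∷_ (trans (cong (n +_) (+-identityʳ n)) (entries b b′)) (double≡shift⊕shift c s t)
  where
  entries : ∀ b b′ → n + n ≡ shiftEntry b b′ n + shiftEntry b′ b n
  entries inside  outside = sym (+-identityʳ (n + n))
  entries outside inside  = refl
  entries inside  inside  = refl
  entries outside outside = refl

·-shift : (π c : Vec ℕ d) (s t : Subset d) →
  π · restrict c s ≡ π · restrict c t → π · shift c s t ≡ π · c
·-shift π c s t ws≡wt = +-cancelʳ-≡ (π · restrict c t) _ _ (begin
  π · shift c s t + π · restrict c t ≡⟨ ·-distribˡ-⊕ π (shift c s t) (restrict c t) ⟨
  π · (shift c s t ⊕ restrict c t)   ≡⟨ cong (π ·_) (shift-⊕-restrict c s t) ⟩
  π · (c ⊕ restrict c s)             ≡⟨ ·-distribˡ-⊕ π c (restrict c s) ⟩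
  π · c + π · restrict c s           ≡⟨ cong (π · c +_) ws≡wt ⟩
  π · c + π · restrict c t           ∎)
  where open ≡-Reasoning

·-restrict-─-≡ : (π c : Vec ℕ d) (s t : Subset d) →
  π · restrict c s ≡ π · restrict c t → π · restrict c (s ─ t) ≡ π · restrict c (t ─ s)
·-restrict-─-≡ π c s t ws≡wt = +-cancelˡ-≡ (weight (s ∩ t)) _ _ (begin
  weight (s ∩ t) + weight (s ─ t) ≡⟨ split s t ⟨
  weight s                        ≡⟨ ws≡wt ⟩
  weight t                        ≡⟨ split t s ⟩
  weight (t ∩ s) + weight (t ─ s) ≡⟨ cong (λ u → weight u + weight (t ─ s)) (∩-comm t s) ⟩
  weight (s ∩ t) + weight (t ─ s) ∎)
  where
  open ≡-Reasoning
  weight : Subset _ → ℕ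
  weight u = π · restrict c u
  split : ∀ u v → weight u ≡ weight (u ∩ v) + weight (u ─ v)
  split u v = trans (cong (π ·_) (restrict-∩-⊕-─ c u v))
                    (·-distribˡ-⊕ π (restrict c (u ∩ v)) (restrict c (u ─ v)))

balance : {π c : Vec ℕ d} {s t : Subset d} → All (0 <_) π →
  π · restrict c s ≡ π · restrict c t →
  Nonempty (supp c ∩ (s ─ t)) → Nonempty (supp c ∩ (t ─ s))
balance {π = π} {c} {s} {t} π>0 ws≡wt ne =
  subst Nonempty (supp-restrict c (t ─ s)) (·-pos⁻ π (restrict c (t ─ s))
    (subst (0 <_) (·-restrict-─-≡ π c s t ws≡wt)
      (·-pos π>0 (subst Nonempty (sym (supp-restrict c (s ─ t))) ne))))

≢⇒Nonempty─ : {s t : Subset d} → s ≢ t → Nonempty (s ─ t) ⊎ Nonempty (t ─ s)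
≢⇒Nonempty─ {s = []}          {[]}          s≢t = contradiction refl s≢t
≢⇒Nonempty─ {s = inside  ∷ _} {outside ∷ _} _   = inj₁ (zero , here)
≢⇒Nonempty─ {s = outside ∷ _} {inside  ∷ _} _   = inj₂ (zero , here)
≢⇒Nonempty─ {s = inside  ∷ _} {inside  ∷ _} s≢t =
  Sum.map (Product.map suc there) (Product.map suc there) (≢⇒Nonempty─ (s≢t ∘ cong (inside ∷_)))
≢⇒Nonempty─ {s = outside ∷ _} {outside ∷ _} s≢t =
  Sum.map (Product.map suc there) (Product.map suc there) (≢⇒Nonempty─ (s≢t ∘ cong (outside ∷_)))

toSide : Fin 2 → Side
toSide zero    = outside
toSide (suc _) = inside

toSide-injective : (i j : Fin 2) → toSide i ≡ toSide j → i ≡ j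
toSide-injective zero       zero       _ = refl
toSide-injective (suc zero) (suc zero) _ = refl

-- Reads the binary digits of a along the positions of supp c.
subsetOf : (c : Vec ℕ d) → Fin (2 ^ ∣ supp c ∣) → Subset d
subsetOf []          _ = []
subsetOf (zero  ∷ c) a = outside ∷ subsetOf c a
subsetOf (suc _ ∷ c) a = toSide digit ∷ subsetOf c rest
  where
  digit : Fin 2
  digit = Product.proj₁ (remQuot {2} (2 ^ ∣ supp c ∣) a)
  rest : Fin (2 ^ ∣ supp c ∣)
  rest = Product.proj₂ (remQuot {2} (2 ^ ∣ supp c ∣) a)

subsetOf-⊆ : (c : Vec ℕ d) (a : Fin (2 ^ ∣ supp c ∣)) → subsetOf c a ⊆ supp c
subsetOf-⊆ (zero  ∷ c) a         (there i∈s) = there (subsetOf-⊆ c a i∈s)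
subsetOf-⊆ (suc _ ∷ c) a {zero}  _           = here
subsetOf-⊆ (suc _ ∷ c) a {suc _} (there i∈s) = there (subsetOf-⊆ c _ i∈s)

subsetOf-injective : (c : Vec ℕ d) {a b : Fin (2 ^ ∣ supp c ∣)} →
  subsetOf c a ≡ subsetOf c b → a ≡ b
subsetOf-injective []          {zero} {zero} _  = refl
subsetOf-injective (zero  ∷ c) eq = subsetOf-injective c (∷-injectiveʳ eq)
subsetOf-injective (suc _ ∷ c) {a} {b} eq = begin
  a                                 ≡⟨ Fin.combine-remQuot {2} k a ⟨
  uncurry combine (remQuot {2} k a) ≡⟨ cong₂ combine digit rest ⟩
  uncurry combine (remQuot {2} k b) ≡⟨ Fin.combine-remQuot {2} k b ⟩
  b                                 ∎
  where
  open ≡-Reasoning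
  k : ℕ
  k = 2 ^ ∣ supp c ∣
  digit : Product.proj₁ (remQuot {2} k a) ≡ Product.proj₁ (remQuot {2} k b)
  digit = toSide-injective _ _ (∷-injectiveˡ eq)
  rest : Product.proj₂ (remQuot {2} k a) ≡ Product.proj₂ (remQuot {2} k b)
  rest = subsetOf-injective c (∷-injectiveʳ eq)

⌊log₂⌋<⇒<2^ : ∀ n k → ⌊log₂ n ⌋ < k → n < 2 ^ k
⌊log₂⌋<⇒<2^ n k log<k = ≰⇒> λ 2^k≤n →
  <⇒≱ log<k (subst (_≤ ⌊log₂ n ⌋) (⌊log₂[2^n]⌋≡n k) (⌊log₂⌋-mono-≤ 2^k≤n))

equal-weight-subsets : (π c : Vec ℕ d) (T : ℕ) → π · c ≤ T → suc T < 2 ^ ∣ supp c ∣ →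
  ∃₂ λ s t → π · restrict c s ≡ π · restrict c t × Nonempty (supp c ∩ (s ─ t))
equal-weight-subsets π c T π·c≤T many =
  let a , b , a<b , fa≡fb = Fin.pigeonhole many weightOf
  in orient (subsetOf-⊆ c a) (subsetOf-⊆ c b) (Fin.fromℕ<-injective _ _ _ _ fa≡fb)
       (≢⇒Nonempty─ (Fin.<⇒≢ a<b ∘ subsetOf-injective c))
  where
  weightOf : Fin (2 ^ ∣ supp c ∣) → Fin (suc T)
  weightOf a = fromℕ< (s≤s (≤-trans (·-restrict-≤ π c (subsetOf c a)) π·c≤T))
  inSupp : ∀ {s t} → s ⊆ supp c → Nonempty (s ─ t) → Nonempty (supp c ∩ (s ─ t))
  inSupp s⊆c (i , i∈s─t) = i , x∈p∩q⁺ (s⊆c (p─q⊆p _ _ i∈s─t) , i∈s─t)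
  orient : ∀ {s t} → s ⊆ supp c → t ⊆ supp c → π · restrict c s ≡ π · restrict c t →
    Nonempty (s ─ t) ⊎ Nonempty (t ─ s) →
    ∃₂ λ s t → π · restrict c s ≡ π · restrict c t × Nonempty (supp c ∩ (s ─ t))
  orient s⊆c _   ws≡wt (inj₁ s∖t) = _ , _ , ws≡wt , inSupp s⊆c s∖t
  orient _   t⊆c ws≡wt (inj₂ t∖s) = _ , _ , sym ws≡wt , inSupp t⊆c t∖s

lemma4 : (d : ℕ) → d ≥ 1 → (π : Vec ℕ d) → All (0 <_) π → (T : ℕ) → T ≥ 1 →
    (c : Vec ℕ d) → InQ π T c → Complex T c →
    Σ (Vec ℕ d) λ c₁ → Σ (Vec ℕ d) λ c₂ →
      InQ π T c₁ × InQ π T c₂ ×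
      (π · c₁ ≡ π · c) × (π · c₂ ≡ π · c) ×
      (double c ≡ zipWith _+_ c₁ c₂) ×
      (supp c₁ ⊂ supp c) × (supp c₂ ⊂ supp c)
lemma4 _ _ π π>0 T _ c π·c≤T complex
  with s , t , ws≡wt , s∖t ← equal-weight-subsets π c T π·c≤T
                                (⌊log₂⌋<⇒<2^ (suc T) ∣ supp c ∣ complex) =
  shift c s t , shift c t s ,
  subst (_≤ T) (sym π·c₁≡π·c) π·c≤T , subst (_≤ T) (sym π·c₂≡π·c) π·c≤T ,
  π·c₁≡π·c , π·c₂≡π·c ,
  double≡shift⊕shift c s t ,
  supp-shift-⊂ c s t (balance π>0 ws≡wt s∖t) , supp-shift-⊂ c t s s∖t
  where
  π·c₁≡π·c : π · shift c s t ≡ π · c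
  π·c₁≡π·c = ·-shift π c s t ws≡wt
  π·c₂≡π·c : π · shift c t s ≡ π · c
  π·c₂≡π·c = ·-shift π c t s (sym ws≡wt)
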